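{- Let $(P,\leq)$ be a finite poset and let $S$ be the multiset of all cardinalities of maximal chains in $P$. Let $m$ be the maximum element of $S$ and let $n=|S|$ (counting multiplicities). Then $|P|\geq m+\log_2(n)$.
   Context: A chain in a poset is a subset any two elements of which are comparable; a chain is maximal if it is not properly contained in any other chain. The multiset of cardinalities of maximal chains of $P$ contains one entry $|C|$ for each maximal chain $C$ of $P$, so its cardinality $|S|$ (counting multiplicities) equals the number of maximal chains of $P$. -}

module Defs where

open import Data.Nat using (ℕ; _⊔_)
open import Data.Fin using (Fin)
open import Data.Fin.Subset using (Subset; _∈_; _⊆_; ∣_∣)
open import Data.List using (List; foldr; map)
open import Data.Sum using (_⊎_)

IsChain : {k : ℕ} → (Fin k → Fin k → Set) → Subset k → Set
IsChain _≤_ C = ∀ x y → x ∈ C → y ∈ C → (x ≤ y) ⊎ (y ≤ x)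

IsMaximalChain : {k : ℕ} → (Fin k → Fin k → Set) → Subset k → Set
IsMaximalChain _≤_ C = IsChain _≤_ C × (∀ D → IsChain _≤_ D → C ⊆ D → D ⊆ C)
  where open import Data.Product using (_×_)

maxList : List ℕ → ℕ
maxList = foldr _⊔_ 0

-- Fix a maximal chain M of largest size m. If C and C' are maximal chains agreeing outside M,
-- then C ∪ (C' ∩ M) is again a chain, so maximality of C forces C' ⊆ C, and symmetrically
-- C ⊆ C'. Hence C ↦ C ∖ M is injective on maximal chains, and its values are among the
-- 2^(|P| - m) subsets of P ∖ M; so n ≤ 2^(|P| - m), i.e. 2^m · n ≤ 2^|P|.
module Submission where

open import Defs
open import Data.Nat using (ℕ; _≤_; _*_; _^_)
open import Data.Fin using (Fin)
open import Data.Fin.Subset using (Subset; ∣_∣)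
open import Data.List using (List; length; map)
open import Data.List.Membership.Propositional using (_∈_)
open import Data.List.Relation.Unary.Unique.Propositional using (Unique)
open import Relation.Binary.PropositionalEquality using (_≡_)
open import Relation.Binary.Structures using (IsPartialOrder)
open import Function.Bundles using (_⇔_)

open import Data.Nat using (suc; _+_; z≤n; s≤s)
open import Data.Nat.Properties using (⊔-sel; ⊔-identityʳ; *-monoʳ-≤; +-identityʳ; *-distribˡ-+; *-assoc)
open import Data.Fin.Subset as Subset using (_∩_; _∪_; ∁; _⊆_; inside; outside)
open import Data.Fin.Subset.Properties
  using (_∈?_; ⊆-antisym; drop-∷-⊆; x∈p∩q⁺; x∈p∩q⁻; p∩q⊆p; p∩q⊆q; x∈p∪q⁻; p⊆p∪q; q⊆p∪q; x∉p⇒x∈∁p)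
open import Data.List using ([]; _∷_; _++_)
open import Data.List.Properties using (length-map; length-++; length-removeAt′)
open import Data.List.Membership.Propositional.Properties using (∈-map⁺; ∈-map⁻; ∈-++⁺ˡ; ∈-++⁺ʳ)
open import Data.List.Relation.Unary.Any using (here; there; _─_)
import Data.List.Relation.Unary.All as All
open import Data.List.Relation.Unary.AllPairs using ([]; _∷_)
open import Data.Vec as Vec using ([]; _∷_)
open import Data.Product using (_,_; proj₁; proj₂)
open import Data.Sum using (_⊎_; inj₁; inj₂; swap)
open import Relation.Nullary using (yes; no; ¬_)
open import Relation.Binary.PropositionalEquality using (_≢_; refl; sym; trans; cong; cong₂; subst; module ≡-Reasoning)
open import Data.Empty using (⊥-elim)
open Function.Bundles.Equivalence using (to)

module _ {A B : Set} where

  ∈-─⁺ : ∀ {x y} (ys : List B) (x∈ys : x ∈ ys) → y ∈ ys → x ≢ y → y ∈ (ys ─ x∈ys)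
  ∈-─⁺ (_ ∷ _)  (here refl) (here refl) x≢y = ⊥-elim (x≢y refl)
  ∈-─⁺ (_ ∷ _)  (here refl) (there y∈)  x≢y = y∈
  ∈-─⁺ (_ ∷ _)  (there x∈)  (here y≡)   x≢y = here y≡
  ∈-─⁺ (_ ∷ ys) (there x∈)  (there y∈)  x≢y = there (∈-─⁺ ys x∈ y∈ x≢y)

  injectiveOn⇒length≤ : (f : A → B) (xs : List A) (ys : List B) → Unique xs →
    (∀ {a b} → a ∈ xs → b ∈ xs → f a ≡ f b → a ≡ b) → (∀ {a} → a ∈ xs → f a ∈ ys) →
    length xs ≤ length ys
  injectiveOn⇒length≤ f []       ys _            _   _    = z≤n
  injectiveOn⇒length≤ f (x ∷ xs) ys (x∉xs ∷ uxs) inj f∈ =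
    subst (suc (length xs) ≤_) (sym (length-removeAt′ ys _))
      (s≤s (injectiveOn⇒length≤ f xs (ys ─ fx∈ys) uxs
        (λ a∈ b∈ → inj (there a∈) (there b∈))
        (λ a∈ → ∈-─⁺ ys fx∈ys (f∈ (there a∈)) (λ fx≡fa → All.lookup x∉xs a∈ (inj (here refl) (there a∈) fx≡fa)))))
    where fx∈ys = f∈ (here refl)

maxList-∈ : ∀ x xs → maxList (x ∷ xs) ∈ x ∷ xs
maxList-∈ x []       = here (⊔-identityʳ x)
maxList-∈ x (y ∷ ys) with ⊔-sel x (maxList (y ∷ ys))
... | inj₁ max≡x = here max≡x
... | inj₂ max≡m = there (subst (_∈ y ∷ ys) (sym max≡m) (maxList-∈ y ys))

subsetsDisjointFrom : ∀ {k} → Subset k → List (Subset k)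
subsetsDisjointFrom []            = [] ∷ []
subsetsDisjointFrom (inside ∷ M)  = map (outside ∷_) (subsetsDisjointFrom M)
subsetsDisjointFrom (outside ∷ M) =
  map (outside ∷_) (subsetsDisjointFrom M) ++ map (inside ∷_) (subsetsDisjointFrom M)

length-subsetsDisjointFrom : ∀ {k} (M : Subset k) → 2 ^ ∣ M ∣ * length (subsetsDisjointFrom M) ≡ 2 ^ k
length-subsetsDisjointFrom []                     = refl
length-subsetsDisjointFrom {suc k} (inside ∷ M)  = begin
  2 ^ suc ∣ M ∣ * length (map (outside ∷_) D) ≡⟨ cong (2 ^ suc ∣ M ∣ *_) (length-map _ D) ⟩
  2 * 2 ^ ∣ M ∣ * length D                    ≡⟨ *-assoc 2 (2 ^ ∣ M ∣) (length D) ⟩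
  2 * (2 ^ ∣ M ∣ * length D)                  ≡⟨ cong (2 *_) (length-subsetsDisjointFrom M) ⟩
  2 ^ suc k                                   ∎
  where open ≡-Reasoning; D = subsetsDisjointFrom M
length-subsetsDisjointFrom {suc k} (outside ∷ M) = begin
  2 ^ ∣ M ∣ * length (map (outside ∷_) D ++ map (inside ∷_) D)
    ≡⟨ cong (2 ^ ∣ M ∣ *_) (length-++ (map (outside ∷_) D)) ⟩
  2 ^ ∣ M ∣ * (length (map (outside ∷_) D) + length (map (inside ∷_) D))
    ≡⟨ cong (2 ^ ∣ M ∣ *_) (cong₂ _+_ (length-map _ D) (length-map _ D)) ⟩
  2 ^ ∣ M ∣ * (length D + length D)
    ≡⟨ *-distribˡ-+ (2 ^ ∣ M ∣) (length D) (length D) ⟩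
  2 ^ ∣ M ∣ * length D + 2 ^ ∣ M ∣ * length D
    ≡⟨ cong₂ _+_ (length-subsetsDisjointFrom M) (trans (length-subsetsDisjointFrom M) (sym (+-identityʳ (2 ^ k)))) ⟩
  2 ^ suc k ∎
  where open ≡-Reasoning; D = subsetsDisjointFrom M

∈-subsetsDisjointFrom : ∀ {k} (M X : Subset k) → X ⊆ ∁ M → X ∈ subsetsDisjointFrom M
∈-subsetsDisjointFrom []            []            _   = here refl
∈-subsetsDisjointFrom (inside ∷ M)  (inside ∷ X)  X⊆∁M with X⊆∁M Vec.here
... | ()
∈-subsetsDisjointFrom (inside ∷ M)  (outside ∷ X) X⊆∁M =
  ∈-map⁺ (outside ∷_) (∈-subsetsDisjointFrom M X (drop-∷-⊆ X⊆∁M))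
∈-subsetsDisjointFrom (outside ∷ M) (outside ∷ X) X⊆∁M =
  ∈-++⁺ˡ (∈-map⁺ (outside ∷_) (∈-subsetsDisjointFrom M X (drop-∷-⊆ X⊆∁M)))
∈-subsetsDisjointFrom (outside ∷ M) (inside ∷ X)  X⊆∁M =
  ∈-++⁺ʳ (map (outside ∷_) (subsetsDisjointFrom M)) (∈-map⁺ (inside ∷_) (∈-subsetsDisjointFrom M X (drop-∷-⊆ X⊆∁M)))

∈-transfer-∩∁ : ∀ {k} {C C' M : Subset k} {x} → C ∩ ∁ M ≡ C' ∩ ∁ M →
  x Subset.∈ C → ¬ (x Subset.∈ M) → x Subset.∈ C'
∈-transfer-∩∁ {C = C} {C'} {M} {x} eq x∈C x∉M =
  p∩q⊆p C' (∁ M) (subst (x Subset.∈_) eq (x∈p∩q⁺ (x∈C , x∉p⇒x∈∁p x∉M)))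

module _ {k : ℕ} {_≼_ : Fin k → Fin k → Set} where

  IsChain-⊆ : ∀ {C D} → D ⊆ C → IsChain _≼_ C → IsChain _≼_ D
  IsChain-⊆ D⊆C chC a b a∈ b∈ = chC a b (D⊆C a∈) (D⊆C b∈)

  IsChain-∪ : ∀ {C D} → IsChain _≼_ C → IsChain _≼_ D →
    (∀ a b → a Subset.∈ C → b Subset.∈ D → (a ≼ b) ⊎ (b ≼ a)) → IsChain _≼_ (C ∪ D)
  IsChain-∪ {C} {D} chC chD cross a b a∈ b∈ with x∈p∪q⁻ C D a∈ | x∈p∪q⁻ C D b∈
  ... | inj₁ a∈C | inj₁ b∈C = chC a b a∈C b∈C
  ... | inj₁ a∈C | inj₂ b∈D = cross a b a∈C b∈D
  ... | inj₂ a∈D | inj₁ b∈C = swap (cross b a b∈C a∈D)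
  ... | inj₂ a∈D | inj₂ b∈D = chD a b a∈D b∈D

  maximalChain-⊇ : ∀ {M C C'} → IsChain _≼_ M → IsMaximalChain _≼_ C → IsChain _≼_ C' →
    C ∩ ∁ M ≡ C' ∩ ∁ M → C' ⊆ C
  maximalChain-⊇ {M} {C} {C'} chM (chC , maxC) chC' eq {x} x∈C' with x ∈? M
  ... | yes x∈M = maxC (C ∪ (C' ∩ M)) chE (p⊆p∪q (C' ∩ M)) (q⊆p∪q C (C' ∩ M) (x∈p∩q⁺ (x∈C' , x∈M)))
    where
    cross : ∀ a b → a Subset.∈ C → b Subset.∈ C' ∩ M → (a ≼ b) ⊎ (b ≼ a)
    cross a b a∈C b∈ with a ∈? M
    ... | yes a∈M = chM a b a∈M (proj₂ (x∈p∩q⁻ C' M b∈))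
    ... | no  a∉M = chC' a b (∈-transfer-∩∁ eq a∈C a∉M) (proj₁ (x∈p∩q⁻ C' M b∈))
    chE : IsChain _≼_ (C ∪ (C' ∩ M))
    chE = IsChain-∪ chC (IsChain-⊆ (p∩q⊆q C' M) chM) cross
  ... | no  x∉M = ∈-transfer-∩∁ (sym eq) x∈C' x∉M

  maximalChain-∩∁-injective : ∀ {M C C'} → IsChain _≼_ M →
    IsMaximalChain _≼_ C → IsMaximalChain _≼_ C' → C ∩ ∁ M ≡ C' ∩ ∁ M → C ≡ C'
  maximalChain-∩∁-injective chM maxC maxC' eq =
    ⊆-antisym (maximalChain-⊇ chM maxC' (proj₁ maxC) (sym eq)) (maximalChain-⊇ chM maxC (proj₁ maxC') eq)

  2^∣chain∣*length-maximalChains≤2^k : ∀ {M} → IsChain _≼_ M →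
    (L : List (Subset k)) → Unique L → (∀ {C} → C ∈ L → IsMaximalChain _≼_ C) →
    2 ^ ∣ M ∣ * length L ≤ 2 ^ k
  2^∣chain∣*length-maximalChains≤2^k {M} chM L uL maxL =
    subst (2 ^ ∣ M ∣ * length L ≤_) (length-subsetsDisjointFrom M)
      (*-monoʳ-≤ (2 ^ ∣ M ∣)
        (injectiveOn⇒length≤ (_∩ ∁ M) L (subsetsDisjointFrom M) uL
          (λ C∈ C'∈ → maximalChain-∩∁-injective chM (maxL C∈) (maxL C'∈))
          (λ {C} _ → ∈-subsetsDisjointFrom M (C ∩ ∁ M) (p∩q⊆q C (∁ M)))))

theorem1 : (k : ℕ) (_≼_ : Fin k → Fin k → Set) → IsPartialOrder _≡_ _≼_ →
    (L : List (Subset k)) → Unique L → (∀ C → (C ∈ L) ⇔ IsMaximalChain _≼_ C) →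
    2 ^ maxList (map ∣_∣ L) * length L ≤ 2 ^ k
theorem1 k _≼_ _ []      _  _       = z≤n
theorem1 k _≼_ _ (C ∷ L) uL maximal with ∈-map⁻ ∣_∣ (maxList-∈ ∣ C ∣ (map ∣_∣ L))
... | M , M∈ , max≡∣M∣ rewrite max≡∣M∣ =
  2^∣chain∣*length-maximalChains≤2^k (proj₁ (to (maximal M) M∈)) (C ∷ L) uL (λ {D} → to (maximal D))
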